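{- For a finite word $w$ over an alphabet $\Sigma$, $SP(w)=|w|$ if and only if $w$ is a block word.
   Context: A word $u$ is a scattered subword of $w$ if $u$ is a (not necessarily contiguous) subsequence of $w$. A palindrome is a word equal to its reversal. $SP(w)$ denotes the number of distinct non-empty palindromes that are scattered subwords of $w$, and $|w|$ is the length of $w$. A word $w$ is a block word if $w=a_1^{n_1}a_2^{n_2}\cdots a_r^{n_r}$ where the letters $a_1,\dots,a_r\in\Sigma$ are pairwise distinct and $n_i\ge 1$. -}

module Defs where

open import Data.List using (List; []; _∷_; _++_; map; length; reverse; filter; deduplicate; concat; replicate)
open import Data.List.Properties using (≡-dec)
open import Data.List.Relation.Unary.AllPairs using (AllPairs)
open import Data.List.Relation.Unary.All using (All)
open import Data.Nat using (ℕ; suc)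
open import Data.Product using (Σ; ∃; _×_; _,_; proj₁)
open import Relation.Binary.PropositionalEquality using (_≡_; _≢_)
open import Relation.Binary.Definitions using (DecidableEquality)
open import Relation.Nullary using (Dec; yes; no; ¬_; _×-dec_)

module _ {Σ : Set} (_≟_ : DecidableEquality Σ) where

  subwords : List Σ → List (List Σ)
  subwords [] = [] ∷ []
  subwords (x ∷ xs) = map (x ∷_) (subwords xs) ++ subwords xs

  IsPalindrome : List Σ → Set
  IsPalindrome u = reverse u ≡ u

  NonEmpty : List Σ → Set
  NonEmpty u = u ≢ []

  nonEmpty? : (u : List Σ) → Dec (NonEmpty u)
  nonEmpty? [] = no (λ ne → ne _≡_.refl)
  nonEmpty? (x ∷ u) = yes (λ ())

  palindrome? : (u : List Σ) → Dec (IsPalindrome u)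
  palindrome? u = ≡-dec _≟_ (reverse u) u

  SP : List Σ → ℕ
  SP w = length (deduplicate (≡-dec _≟_)
           (filter (λ u → nonEmpty? u ×-dec palindrome? u) (subwords w)))

-- w is a block word: w = a₁^{n₁} ⋯ a_r^{n_r}, a_i pairwise distinct, n_i ≥ 1.
-- Blocks given as a list of pairs (a_i , m_i) with n_i = suc m_i.
IsBlockWord : {Σ : Set} → List Σ → Set
IsBlockWord {Σ} w =
  ∃ λ (bs : List (Σ × ℕ)) →
    AllPairs (λ p q → proj₁ p ≢ proj₁ q) bs ×
    w ≡ concat (map (λ { (a , m) → replicate (suc m) a }) bs)

{-# OPTIONS --safe #-}
-- Each occurrence of a letter x in w, read from the right, gives a new unary palindrome
-- x^(1 + number of x's after it), so w has |w| distinct palindromic subwords that are powers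
-- of a single letter, and SP(w) ≥ |w| with equality iff every palindromic subword is unary.
-- In a block word a palindrome cannot leave the block in which it starts: its last letter
-- equals its first, which does not occur in later blocks.  Every other word contains x a x
-- with x ≢ a, a palindrome that is not unary.
module Submission where

open import Defs
open import Data.List using (List; []; _∷_; [_]; _++_; map; length; reverse; filter; deduplicate; concat; replicate; initLast; _∷ʳ′_)
open import Data.List.Properties using (≡-dec; ∷-injectiveˡ; ++-identityʳ; ++-assoc; unfold-reverse; reverse-++; length-replicate; length-removeAt′; filter-all)
open import Data.List.Membership.Propositional using (_∈_; _∉_)
open import Data.List.Membership.Propositional.Properties using (∈-map⁺; ∈-map⁻; ∈-++⁺ˡ; ∈-++⁺ʳ; ∈-++⁻; ∈-filter⁺; ∈-filter⁻; ∈-deduplicate⁺; ∈-deduplicate⁻)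
open import Data.List.Relation.Binary.Sublist.Propositional using (_⊆_; []; _∷_; _∷ʳ_; ⊆-trans; lookup; from∈)
open import Data.List.Relation.Binary.Sublist.Propositional.Properties using ([]⊆-universal; filter-⊆; filter⁺; length-mono-≤)
import Data.List.Relation.Binary.Subset.Propositional as Subset
open import Data.List.Relation.Unary.All using (All; []; _∷_)
import Data.List.Relation.Unary.All as All
open import Data.List.Relation.Unary.All.Properties using (all-filter; replicate⁺)
open import Data.List.Relation.Unary.AllPairs using (AllPairs; []; _∷_)
open import Data.List.Relation.Unary.Any using (here; there; index; _─_)
open import Data.List.Relation.Unary.Unique.Propositional using (Unique)
open import Data.List.Relation.Unary.Unique.DecPropositional.Properties using (deduplicate-!)
open import Data.Nat using (ℕ; zero; suc; _≤_; _<_; z≤n; s≤s)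
open import Data.Nat.Properties using (≤-antisym; <⇒≢; ≤∧≢⇒<; <-irrefl; module ≤-Reasoning)
import Data.Nat.Properties as ℕ
open import Data.Product using (∃; ∃₂; _×_; _,_; proj₁; proj₂)
open import Data.Sum using (_⊎_; inj₁; inj₂)
open import Function.Bundles using (_⇔_; mk⇔)
open import Relation.Binary.Definitions using (DecidableEquality)
open import Relation.Binary.PropositionalEquality using (_≡_; _≢_; refl; sym; cong; subst; module ≡-Reasoning)
open import Relation.Nullary using (¬_; Dec; yes; no; contradiction; _×-dec_)

private
  variable
    A : Set
    a x y z : A
    xs ys : List A

∈-─⁺ : (p : x ∈ ys) → z ∈ ys → z ≢ x → z ∈ (ys ─ p)
∈-─⁺ (here refl) (here refl) z≢x = contradiction refl z≢x
∈-─⁺ (here refl) (there q)   _   = q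
∈-─⁺ (there p)   (here q)    _   = here q
∈-─⁺ (there p)   (there q)   z≢x = there (∈-─⁺ p q z≢x)

unique-⊆⇒length≤ : Unique xs → xs Subset.⊆ ys → length xs ≤ length ys
unique-⊆⇒length≤ {xs = []} _ _ = z≤n
unique-⊆⇒length≤ {xs = x ∷ xs} {ys} (x∉xs ∷ xs!) x∷xs⊆ys = begin
  suc (length xs)          ≤⟨ s≤s (unique-⊆⇒length≤ xs! xs⊆ys─x) ⟩
  suc (length (ys ─ x∈ys)) ≡⟨ length-removeAt′ ys (index x∈ys) ⟨
  length ys                ∎
  where
  open ≤-Reasoning
  x∈ys = x∷xs⊆ys (here refl)
  xs⊆ys─x : xs Subset.⊆ (ys ─ x∈ys)
  xs⊆ys─x z∈xs = ∈-─⁺ x∈ys (x∷xs⊆ys (there z∈xs)) (λ z≡x → All.lookup x∉xs z∈xs (sym z≡x))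

All≡⇒replicate : All (a ≡_) xs → xs ≡ replicate (length xs) a
All≡⇒replicate []         = refl
All≡⇒replicate (refl ∷ p) = cong (_ ∷_) (All≡⇒replicate p)

replicate⁺-⊆ : ∀ {m n} → m ≤ n → replicate m a ⊆ replicate n a
replicate⁺-⊆ {m = zero} _ = []⊆-universal _
replicate⁺-⊆ (s≤s m≤n)   = refl ∷ replicate⁺-⊆ m≤n

reverse-replicate : ∀ n (a : A) → reverse (replicate n a) ≡ replicate n a
reverse-replicate zero    a = refl
reverse-replicate (suc n) a = begin
  reverse (a ∷ replicate n a)      ≡⟨ unfold-reverse a (replicate n a) ⟩
  reverse (replicate n a) ++ [ a ] ≡⟨ cong (_++ [ a ]) (reverse-replicate n a) ⟩
  replicate n a ++ [ a ]           ≡⟨ replicate-++-[] n ⟩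
  a ∷ replicate n a                ∎
  where
  open ≡-Reasoning
  replicate-++-[] : ∀ n → replicate n a ++ [ a ] ≡ a ∷ replicate n a
  replicate-++-[] zero    = refl
  replicate-++-[] (suc n) = cong (a ∷_) (replicate-++-[] n)

palindrome-head≡last : reverse (x ∷ xs ++ [ y ]) ≡ x ∷ xs ++ [ y ] → x ≡ y
palindrome-head≡last {x = x} {xs} {y} pal = sym (∷-injectiveˡ (begin
  y ∷ reverse xs ++ [ x ]        ≡⟨ cong (_++ [ x ]) (reverse-++ xs [ y ]) ⟨
  reverse (xs ++ [ y ]) ++ [ x ] ≡⟨ unfold-reverse x (xs ++ [ y ]) ⟨
  reverse (x ∷ xs ++ [ y ])      ≡⟨ pal ⟩
  x ∷ xs ++ [ y ]                ∎))
  where open ≡-Reasoning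

Unary : List A → Set
Unary u = ∃₂ λ n a → u ≡ replicate (suc n) a

xax-nonUnary : x ≢ a → ¬ Unary (x ∷ a ∷ x ∷ [])
xax-nonUnary x≢a (suc (suc zero) , _ , refl) = x≢a refl
xax-nonUnary x≢a (zero , _ , ())
xax-nonUnary x≢a (suc zero , _ , ())
xax-nonUnary x≢a (suc (suc (suc _)) , _ , ())

block : A × ℕ → List A
block (a , m) = replicate (suc m) a

blockWord : List (A × ℕ) → List A
blockWord bs = concat (map block bs)

DistinctLetters : List (A × ℕ) → Set
DistinctLetters = AllPairs (λ p q → proj₁ p ≢ proj₁ q)

All≢⇒∉blockWord : ∀ bs → All (λ q → x ≢ proj₁ q) bs → x ∉ blockWord bs
All≢⇒∉blockWord ((b , m) ∷ bs) (x≢b ∷ x≢bs) x∈ with ∈-++⁻ (replicate (suc m) b) x∈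
... | inj₁ x∈bᵐ   = x≢b (All.lookup (replicate⁺ {P = _≡ b} (suc m) refl) x∈bᵐ)
... | inj₂ x∈rest = All≢⇒∉blockWord bs x≢bs x∈rest

∉blockWord⇒All≢ : ∀ bs → x ∉ blockWord bs → All (λ q → x ≢ proj₁ q) bs
∉blockWord⇒All≢ []             _  = []
∉blockWord⇒All≢ ((b , m) ∷ bs) x∉ =
  (λ x≡b → x∉ (here x≡b)) ∷ ∉blockWord⇒All≢ bs (λ x∈ → x∉ (∈-++⁺ʳ (replicate (suc m) b) x∈))

⊆-replicate-++⁻ : ∀ k {u r} → u ⊆ replicate k a ++ r →
                  ∃₂ λ j v → u ≡ replicate j a ++ v × v ⊆ r
⊆-replicate-++⁻ zero    u⊆r       = 0 , _ , refl , u⊆r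
⊆-replicate-++⁻ (suc k) (_ ∷ʳ u⊆) = ⊆-replicate-++⁻ k u⊆
⊆-replicate-++⁻ (suc k) (refl ∷ u⊆)
  with j , v , refl , v⊆r ← ⊆-replicate-++⁻ k u⊆ = suc j , v , refl , v⊆r

module _ {A : Set} (_≟_ : DecidableEquality A) where

  open import Data.List.Membership.DecPropositional _≟_ using (_∈?_)

  ∈-subwords⁺ : ∀ {u w} → u ⊆ w → u ∈ subwords _≟_ w
  ∈-subwords⁺ []                      = here refl
  ∈-subwords⁺ {w = x ∷ w} (.x ∷ʳ u⊆w) = ∈-++⁺ʳ (map (x ∷_) (subwords _≟_ w)) (∈-subwords⁺ u⊆w)
  ∈-subwords⁺ (refl ∷ u⊆w)            = ∈-++⁺ˡ (∈-map⁺ (_ ∷_) (∈-subwords⁺ u⊆w))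

  ∈-subwords⁻ : ∀ {u} w → u ∈ subwords _≟_ w → u ⊆ w
  ∈-subwords⁻ []      (here refl) = []
  ∈-subwords⁻ (x ∷ w) u∈ with ∈-++⁻ (map (x ∷_) (subwords _≟_ w)) u∈
  ... | inj₁ u∈keep with v , v∈ , refl ← ∈-map⁻ (x ∷_) u∈keep = refl ∷ ∈-subwords⁻ w v∈
  ... | inj₂ u∈skip = x ∷ʳ ∈-subwords⁻ w u∈skip

  PalindromicSubword : List A → List A → Set
  PalindromicSubword w u = u ⊆ w × NonEmpty _≟_ u × IsPalindrome _≟_ u

  nonEmptyPalindrome? : (u : List A) → Dec (NonEmpty _≟_ u × IsPalindrome _≟_ u)
  nonEmptyPalindrome? u = nonEmpty? _≟_ u ×-dec palindrome? _≟_ u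

  palindromes : List A → List (List A)
  palindromes w = deduplicate (≡-dec _≟_) (filter nonEmptyPalindrome? (subwords _≟_ w))

  ∈-palindromes⁺ : ∀ {w u} → PalindromicSubword w u → u ∈ palindromes w
  ∈-palindromes⁺ (u⊆w , u≢[] , pal) =
    ∈-deduplicate⁺ (≡-dec _≟_) (∈-filter⁺ nonEmptyPalindrome? (∈-subwords⁺ u⊆w) (u≢[] , pal))

  ∈-palindromes⁻ : ∀ {w u} → u ∈ palindromes w → PalindromicSubword w u
  ∈-palindromes⁻ {w} u∈
    with u∈sw , u≢[] , pal ← ∈-filter⁻ nonEmptyPalindrome? (∈-deduplicate⁻ (≡-dec _≟_) _ u∈) =
    ∈-subwords⁻ w u∈sw , u≢[] , pal

  count : A → List A → ℕ
  count a w = length (filter (a ≟_) w)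

  replicate-count-⊆ : ∀ a w → replicate (count a w) a ⊆ w
  replicate-count-⊆ a w =
    subst (_⊆ w) (All≡⇒replicate (all-filter (a ≟_) w)) (filter-⊆ (a ≟_) w)

  replicate-⊆⇒≤count : ∀ {n a w} → replicate n a ⊆ w → n ≤ count a w
  replicate-⊆⇒≤count {n} {a} {w} aⁿ⊆w = begin
    n                                        ≡⟨ length-replicate n ⟨
    length (replicate n a)                   ≡⟨ cong length (filter-all (a ≟_) (replicate⁺ n refl)) ⟨
    length (filter (a ≟_) (replicate n a))   ≤⟨ length-mono-≤ (filter⁺ (a ≟_) (a ≟_) (λ { refl a≡ → a≡ }) aⁿ⊆w) ⟩
    count a w                                ∎
    where open ≤-Reasoning

  unary-palindrome : ∀ {u} → Unary u → IsPalindrome _≟_ u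
  unary-palindrome (n , a , refl) = reverse-replicate (suc n) a

  unary-nonEmpty : ∀ {u} → Unary u → NonEmpty _≟_ u
  unary-nonEmpty (n , a , refl) ()

  unarySubwords : List A → List (List A)
  unarySubwords []      = []
  unarySubwords (x ∷ w) = replicate (suc (count x w)) x ∷ unarySubwords w

  length-unarySubwords : ∀ w → length (unarySubwords w) ≡ length w
  length-unarySubwords []      = refl
  length-unarySubwords (x ∷ w) = cong suc (length-unarySubwords w)

  ∈-unarySubwords⁻ : ∀ {u} w → u ∈ unarySubwords w → Unary u × u ⊆ w
  ∈-unarySubwords⁻ (x ∷ w) (here refl) = (count x w , x , refl) , refl ∷ replicate-count-⊆ x w
  ∈-unarySubwords⁻ (x ∷ w) (there u∈) with unary , u⊆w ← ∈-unarySubwords⁻ w u∈ = unary , x ∷ʳ u⊆w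

  ∈-unarySubwords⁺ : ∀ {u} w → Unary u → u ⊆ w → u ∈ unarySubwords w
  ∈-unarySubwords⁺ (x ∷ w) unary                 (.x ∷ʳ u⊆w)   = there (∈-unarySubwords⁺ w unary u⊆w)
  ∈-unarySubwords⁺ (x ∷ w) unary@(n , .x , refl) (refl ∷ xⁿ⊆w)
    with n ℕ.≟ count x w
  ... | yes refl = here refl
  ... | no n≢count = there (∈-unarySubwords⁺ w unary
          (⊆-trans (replicate⁺-⊆ (≤∧≢⇒< (replicate-⊆⇒≤count xⁿ⊆w) n≢count)) (replicate-count-⊆ x w)))

  unarySubwords-unique : ∀ w → Unique (unarySubwords w)
  unarySubwords-unique []      = []
  unarySubwords-unique (x ∷ w) = All.tabulate new ∷ unarySubwords-unique w
    where
    new : ∀ {u} → u ∈ unarySubwords w → replicate (suc (count x w)) x ≢ u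
    new u∈ refl = <-irrefl refl (replicate-⊆⇒≤count (proj₂ (∈-unarySubwords⁻ w u∈)))

  unarySubwords⊆palindromes : ∀ w → unarySubwords w Subset.⊆ palindromes w
  unarySubwords⊆palindromes w u∈ with unary , u⊆w ← ∈-unarySubwords⁻ w u∈ =
    ∈-palindromes⁺ (u⊆w , unary-nonEmpty unary , unary-palindrome unary)

  length≤SP : ∀ w → length w ≤ SP _≟_ w
  length≤SP w = subst (_≤ SP _≟_ w) (length-unarySubwords w)
    (unique-⊆⇒length≤ (unarySubwords-unique w) (unarySubwords⊆palindromes w))

  UnaryPalindromes : List A → Set
  UnaryPalindromes w = ∀ {u} → PalindromicSubword w u → Unary u

  SP≤length : ∀ {w} → UnaryPalindromes w → SP _≟_ w ≤ length w
  SP≤length {w} unaryPals = subst (SP _≟_ w ≤_) (length-unarySubwords w)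
    (unique-⊆⇒length≤ (deduplicate-! (≡-dec _≟_) _) palindromes⊆unarySubwords)
    where
    palindromes⊆unarySubwords : palindromes w Subset.⊆ unarySubwords w
    palindromes⊆unarySubwords u∈ with psw ← ∈-palindromes⁻ u∈ =
      ∈-unarySubwords⁺ w (unaryPals psw) (proj₁ psw)

  length<SP : ∀ {w u} → PalindromicSubword w u → ¬ Unary u → length w < SP _≟_ w
  length<SP {w} {u} psw nonUnary = subst (λ n → suc n ≤ SP _≟_ w) (length-unarySubwords w)
    (unique-⊆⇒length≤ (All.tabulate u∉ ∷ unarySubwords-unique w) u∷unary⊆palindromes)
    where
    u∉ : ∀ {v} → v ∈ unarySubwords w → u ≢ v
    u∉ v∈ refl = nonUnary (proj₁ (∈-unarySubwords⁻ w v∈))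
    u∷unary⊆palindromes : (u ∷ unarySubwords w) Subset.⊆ palindromes w
    u∷unary⊆palindromes (here refl) = ∈-palindromes⁺ psw
    u∷unary⊆palindromes (there v∈)  = unarySubwords⊆palindromes w v∈

  replicate-++-unaryPalindromes : ∀ k {a r} → a ∉ r → UnaryPalindromes r →
                                  UnaryPalindromes (replicate k a ++ r)
  replicate-++-unaryPalindromes k {a} {r} a∉r unaryPals (u⊆ , u≢[] , pal)
    with ⊆-replicate-++⁻ k u⊆
  ... | zero  , v , refl , v⊆r = unaryPals (v⊆r , u≢[] , pal)
  ... | suc j , v , refl , v⊆r with initLast v
  ...   | []      = j , a , cong (a ∷_) (++-identityʳ (replicate j a))
  ...   | s ∷ʳ′ y = contradiction (subst (_∈ r) (sym a≡y) y∈r) a∉r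
    where
    y∈r : y ∈ r
    y∈r = lookup v⊆r (∈-++⁺ʳ s (here refl))
    a≡y : a ≡ y
    a≡y = palindrome-head≡last
      (subst (λ t → reverse t ≡ t) (cong (a ∷_) (sym (++-assoc (replicate j a) s [ y ]))) pal)

  blockWord-unaryPalindromes : ∀ {bs} → DistinctLetters bs → UnaryPalindromes (blockWord bs)
  blockWord-unaryPalindromes {[]}           []                ([] , u≢[] , _) = contradiction refl u≢[]
  blockWord-unaryPalindromes {(a , m) ∷ bs} (a∉bs ∷ distinct) =
    replicate-++-unaryPalindromes (suc m) (All≢⇒∉blockWord bs a∉bs) (blockWord-unaryPalindromes distinct)

  -- Stated via blockWord: the pattern lambda inside IsBlockWord closes over w,
  -- so an IsBlockWord equation cannot be matched against refl.
  isBlockWord⊎xax⊆ : ∀ w → (∃ λ bs → DistinctLetters bs × w ≡ blockWord bs)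
                          ⊎ (∃₂ λ x a → x ≢ a × x ∷ a ∷ x ∷ [] ⊆ w)
  isBlockWord⊎xax⊆ []      = inj₁ ([] , [] , refl)
  isBlockWord⊎xax⊆ (x ∷ w) with isBlockWord⊎xax⊆ w
  ... | inj₂ (y , a , y≢a , yay⊆w) = inj₂ (y , a , y≢a , x ∷ʳ yay⊆w)
  ... | inj₁ ([] , [] , refl) = inj₁ ([ x , 0 ] , [] ∷ [] , refl)
  ... | inj₁ ((a , m) ∷ bs , a∉bs ∷ distinct , refl) with x ≟ a | x ∈? blockWord ((a , m) ∷ bs)
  ...   | yes refl | _              = inj₁ ((x , suc m) ∷ bs , a∉bs ∷ distinct , refl)
  ...   | no x≢a   | no x∉          =
          inj₁ ((x , 0) ∷ (a , m) ∷ bs , ∉blockWord⇒All≢ ((a , m) ∷ bs) x∉ ∷ a∉bs ∷ distinct , refl)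
  ...   | no x≢a   | yes (here x≡a) = contradiction x≡a x≢a
  ...   | no x≢a   | yes (there x∈) = inj₂ (x , a , x≢a , refl ∷ refl ∷ from∈ x∈)

  blockWord-SP≡length : ∀ {bs} → DistinctLetters bs → SP _≟_ (blockWord bs) ≡ length (blockWord bs)
  blockWord-SP≡length {bs} distinct =
    ≤-antisym (SP≤length (blockWord-unaryPalindromes distinct)) (length≤SP (blockWord bs))

  isBlockWord⇒SP≡length : ∀ {w} → IsBlockWord w → SP _≟_ w ≡ length w
  isBlockWord⇒SP≡length (bs , distinct , w≡) =
    subst (λ v → SP _≟_ v ≡ length v) (sym w≡) (blockWord-SP≡length distinct)

  SP≡length⇒isBlockWord : ∀ w → SP _≟_ w ≡ length w → IsBlockWord w
  SP≡length⇒isBlockWord w SP≡length with isBlockWord⊎xax⊆ w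
  ... | inj₁ isBlockWord = isBlockWord
  ... | inj₂ (x , a , x≢a , xax⊆w) =
        contradiction (sym SP≡length) (<⇒≢ (length<SP (xax⊆w , (λ ()) , refl) (xax-nonUnary x≢a)))

theorem3p6 : {Σ : Set} (_≟_ : DecidableEquality Σ) (w : List Σ) →
    (SP _≟_ w ≡ length w) ⇔ IsBlockWord w
theorem3p6 _≟_ w = mk⇔ (SP≡length⇒isBlockWord _≟_ w) (isBlockWord⇒SP≡length _≟_)
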